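{- Let $S=-S\subset\mathbb{Z}^n$ be a finite generating set of $\mathbb{Z}^n$, $P=\mathrm{conv}(S)$, and consider the unweighted Cayley graph $(\mathbb{Z}^n,S)$. Let $\gamma$ and $\eta$ be full geodesics, all of whose steps lie in their respective directions, whose directions are the vertex sets of distinct faces $F$ and $G$ of $P$ respectively. Then $\gamma$ and $\eta$ are not equivalent.
   Context: Cayley graph: vertex set $\mathbb{Z}^n$, $u,v$ adjacent iff $u-v\in S$; $d$ is graph distance. $\phi_{y,z}(x)=d(x,y)-d(x,z)$; $B$ is the $\mathbb{Z}$-algebra of functions $\mathbb{Z}^n\to\mathbb{Z}$ generated by constants and all $\phi_{y,z}$. A full geodesic is a sequence $\gamma_0,\gamma_1,\ldots$ with $d(\gamma_i,\gamma_j)=j-i$ for all $i<j$; its steps are $\gamma_i-\gamma_{i-1}\in S$; its direction is the set of elements of $S$ occurring infinitely often among its steps. $v_\gamma(f)=\lim_n f(\gamma_n)$ for $f\in B$. Geodesics $\gamma,\eta$ are equivalent if $v_\gamma=v_\eta$. -}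

module Defs where

open import Data.Nat as ℕ using (ℕ; zero; suc; _≤_; _<_; _∸_)
open import Data.Integer as ℤ using (ℤ; +_)
open import Data.List using (List; []; _∷_; length; foldr)
open import Data.List.Membership.Propositional using (_∈_)
open import Data.List.Relation.Unary.All using (All)
open import Data.Vec as Vec using (Vec; replicate; zipWith)
open import Data.Product using (Σ; ∃; _×_; _,_; proj₁; proj₂)
open import Data.Sum using (_⊎_)
open import Data.Empty using (⊥)
open import Relation.Binary.PropositionalEquality using (_≡_; _≢_)
open import Relation.Nullary using (¬_)
open import Function.Bundles using (_⇔_)

Pt : ℕ → Set
Pt n = Vec ℤ n

module _ {n : ℕ} where

  𝟎 : Pt n
  𝟎 = replicate n (+ 0)

  _⊕_ : Pt n → Pt n → Pt n
  _⊕_ = zipWith ℤ._+_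

  ⊝_ : Pt n → Pt n
  ⊝ v = Vec.map (λ a → ℤ.- a) v

  _⊖_ : Pt n → Pt n → Pt n
  u ⊖ v = u ⊕ (⊝ v)

  _•_ : ℕ → Pt n → Pt n
  k • v = Vec.map (ℤ._*_ (+ k)) v

  _·_ : Pt n → Pt n → ℤ
  u · v = Vec.foldr _ ℤ._+_ (+ 0) (zipWith ℤ._*_ u v)

  walkSum : List (Pt n) → Pt n
  walkSum = foldr _⊕_ 𝟎

  Symmetric : List (Pt n) → Set
  Symmetric S = ∀ s → s ∈ S → (⊝ s) ∈ S

  -- S generates ℤ^n (as a group; since S = -S this is the same as
  -- every vector being a finite sum of elements of S)
  Generates : List (Pt n) → Set
  Generates S = ∀ v → Σ (List (Pt n)) λ w → All (_∈ S) w × walkSum w ≡ v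

  IsCayleyDist : List (Pt n) → (Pt n → Pt n → ℕ) → Set
  IsCayleyDist S d = ∀ x y →
      (Σ (List (Pt n)) λ w → All (_∈ S) w × length w ≡ d x y × x ⊕ walkSum w ≡ y)
    × (∀ (w : List (Pt n)) → All (_∈ S) w → x ⊕ walkSum w ≡ y → d x y ≤ length w)

  -- The algebra B: generated (as a ℤ-algebra) by constants and the φ_{y,z}.
  -- Elements of B are exactly the evaluations of these expressions.

  data BExpr : Set where
    const : ℤ → BExpr
    phi   : Pt n → Pt n → BExpr
    add   : BExpr → BExpr → BExpr
    mul   : BExpr → BExpr → BExpr
    neg   : BExpr → BExpr

  φ : (Pt n → Pt n → ℕ) → Pt n → Pt n → Pt n → ℤ
  φ d y z x = (+ d x y) ℤ.- (+ d x z)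

  eval : (Pt n → Pt n → ℕ) → BExpr → Pt n → ℤ
  eval d (const c) x = c
  eval d (phi y z) x = φ d y z x
  eval d (add e f) x = eval d e x ℤ.+ eval d f x
  eval d (mul e f) x = eval d e x ℤ.* eval d f x
  eval d (neg e)   x = ℤ.- eval d e x

  FullGeodesic : (Pt n → Pt n → ℕ) → (ℕ → Pt n) → Set
  FullGeodesic d γ = ∀ i j → i < j → d (γ i) (γ j) ≡ j ∸ i

  step : (ℕ → Pt n) → ℕ → Pt n
  step γ m = γ (suc m) ⊖ γ m

  InDirection : (ℕ → Pt n) → Pt n → Set
  InDirection γ v = ∀ N → ∃ λ m → N ≤ m × step γ m ≡ v

  AllStepsInDirection : (ℕ → Pt n) → Set
  AllStepsInDirection γ = ∀ m → InDirection γ (step γ m)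

  -- v lies in the convex hull of the points of S different from v
  -- (rational convex combination, denominators cleared:
  --  (Σ k_i) v = Σ k_i t_i with k_i ∈ ℕ, Σ k_i > 0, t_i ∈ S, t_i ≠ v)
  InHullOfOthers : List (Pt n) → Pt n → Set
  InHullOfOthers S v = Σ (List (ℕ × Pt n)) λ ws →
      All (λ kt → proj₂ kt ∈ S × proj₂ kt ≢ v) ws
    × 0 < foldr (λ kt acc → proj₁ kt ℕ.+ acc) 0 ws
    × (foldr (λ kt acc → proj₁ kt ℕ.+ acc) 0 ws) • v
        ≡ foldr (λ kt acc → (proj₁ kt • proj₂ kt) ⊕ acc) 𝟎 ws

  IsVertex : List (Pt n) → Pt n → Set
  IsVertex S v = v ∈ S × ¬ InHullOfOthers S v

  -- A face of P: either the empty face, or the face exposed by the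
  -- (integral) linear functional c, i.e. {x ∈ P : c·x = max_P c}.
  data Face : Set where
    emptyFace : Face
    exposed   : Pt n → Face

  FaceVertex : List (Pt n) → Face → Pt n → Set
  FaceVertex S emptyFace   v = ⊥
  FaceVertex S (exposed c) v = IsVertex S v × (∀ t → t ∈ S → (c · t) ℤ.≤ (c · v))

  -- two faces are the same face (a face is the convex hull of its vertex set)
  SameFace : List (Pt n) → Face → Face → Set
  SameFace S F G = ∀ v → FaceVertex S F v ⇔ FaceVertex S G v

  DirectionIsVertexSetOf : List (Pt n) → (ℕ → Pt n) → Face → Set
  DirectionIsVertexSetOf S γ F = ∀ v → InDirection γ v ⇔ FaceVertex S F v

  -- integer sequence with limit a (i.e. eventually equal to a)
  HasLimit : (ℕ → ℤ) → ℤ → Set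
  HasLimit s a = ∃ λ N → ∀ m → N ≤ m → s m ≡ a

  Equivalent : (Pt n → Pt n → ℕ) → (ℕ → Pt n) → (ℕ → Pt n) → Set
  Equivalent d γ η = ∀ (e : BExpr) (a : ℤ) →
    HasLimit (λ m → eval d e (γ m)) a ⇔ HasLimit (λ m → eval d e (η m)) a

-- Suppose v is a vertex of F but not of G, and let f = φ_{y,y+v} with y = η₀.
-- Along γ: the defect d(γ₀,y) + d(γ_m,y) − m ∈ ℕ is (classically) minimal at some N, so
-- from N on γ recedes from y at unit speed.  Translating y → γ_N → γ_p by a later step
-- v = γ_{p+1} − γ_p gives d(γ_m, y+v) = d(γ_m, y) − 1 for m > p, hence f(γ_m) → 1.
-- Along η: G is exposed by some c with c·s = M on every step of η, c ≤ M on S and c·v < M;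
-- a walk of length m − 1 from y+v to η_m would give c·η_m − c·y ≤ c·v + (m−1)M < mM,
-- so f(η_m) ≠ 1.  Only the choice of N is non-constructive, and face membership is
-- ¬¬-stable, so this suffices.

module Submission where

open import Data.Integer as ℤ using (ℤ; +_)
import Data.Integer.Properties as ℤP
open import Data.Integer.Tactic.RingSolver using (solve-∀)
open import Data.List using (List; []; _∷_; length; _++_; map)
open import Data.List.Membership.Propositional using (_∈_)
import Data.List.Membership.DecPropositional as DecMembership
open import Data.List.Properties using (length-++; length-map)
open import Data.List.Relation.Unary.All as All using (All; []; _∷_)
open import Data.List.Relation.Unary.All.Properties using (++⁺; map⁺)
open import Data.Nat as ℕ using (ℕ; zero; suc; _+_; _∸_; _≤_; _<_; _≤?_; s≤s)
import Data.Nat.Properties as ℕP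
import Data.Nat.Tactic.RingSolver as ℕSolver
open import Data.Product using (∃; _×_; _,_; proj₁; proj₂)
open import Data.Vec using ([]; _∷_)
open import Data.Vec.Properties
  using (zipWith-assoc; zipWith-comm; zipWith-identityˡ; zipWith-identityʳ; zipWith-inverseʳ; map-replicate; ≡-dec)
open import Function using (_∘_)
open import Function.Bundles using (_⇔_; mk⇔; Equivalence)
import Function.Properties.Equivalence as ⇔
open import Relation.Binary.PropositionalEquality
open import Relation.Nullary using (¬_)
open import Relation.Nullary.Decidable using (decidable-stable)
open import Relation.Nullary.Negation using (Stable; negated-stable; ¬¬-map)

open import Defs

⊕-assoc : ∀ {n} (x y z : Pt n) → (x ⊕ y) ⊕ z ≡ x ⊕ (y ⊕ z)
⊕-assoc = zipWith-assoc ℤP.+-assoc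

⊕-comm : ∀ {n} (x y : Pt n) → x ⊕ y ≡ y ⊕ x
⊕-comm = zipWith-comm ℤP.+-comm

⊕-identityˡ : ∀ {n} (x : Pt n) → 𝟎 ⊕ x ≡ x
⊕-identityˡ = zipWith-identityˡ ℤP.+-identityˡ

⊕-identityʳ : ∀ {n} (x : Pt n) → x ⊕ 𝟎 ≡ x
⊕-identityʳ = zipWith-identityʳ ℤP.+-identityʳ

⊕-inverseʳ : ∀ {n} (x : Pt n) → x ⊖ x ≡ 𝟎
⊕-inverseʳ = zipWith-inverseʳ ℤP.+-inverseʳ

⊝-distrib-⊕ : ∀ {n} (x y : Pt n) → ⊝ (x ⊕ y) ≡ (⊝ x) ⊕ (⊝ y)
⊝-distrib-⊕ []      []      = refl
⊝-distrib-⊕ (a ∷ x) (b ∷ y) = cong₂ _∷_ (ℤP.neg-distrib-+ a b) (⊝-distrib-⊕ x y)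

⊝-𝟎 : ∀ {n} → ⊝ 𝟎 ≡ 𝟎 {n}
⊝-𝟎 {n} = map-replicate ℤ.-_ (+ 0) n

x⊕[y⊖x]≡y : ∀ {n} (x y : Pt n) → x ⊕ (y ⊖ x) ≡ y
x⊕[y⊖x]≡y x y = begin
  x ⊕ (y ⊕ (⊝ x))   ≡⟨ cong (x ⊕_) (⊕-comm y (⊝ x)) ⟩
  x ⊕ ((⊝ x) ⊕ y)   ≡⟨ ⊕-assoc x (⊝ x) y ⟨
  (x ⊖ x) ⊕ y       ≡⟨ cong (_⊕ y) (⊕-inverseʳ x) ⟩
  𝟎 ⊕ y             ≡⟨ ⊕-identityˡ y ⟩
  y                 ∎
  where open ≡-Reasoning

[x⊕y]⊖y≡x : ∀ {n} (x y : Pt n) → (x ⊕ y) ⊖ y ≡ x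
[x⊕y]⊖y≡x x y = begin
  (x ⊕ y) ⊖ y       ≡⟨ ⊕-assoc x y (⊝ y) ⟩
  x ⊕ (y ⊖ y)       ≡⟨ cong (x ⊕_) (⊕-inverseʳ y) ⟩
  x ⊕ 𝟎             ≡⟨ ⊕-identityʳ x ⟩
  x                 ∎
  where open ≡-Reasoning

·-distribˡ-⊕ : ∀ {n} (c x y : Pt n) → c · (x ⊕ y) ≡ c · x ℤ.+ c · y
·-distribˡ-⊕ []      []      []       = refl
·-distribˡ-⊕ (a ∷ c) (b ∷ x) (b′ ∷ y) =
  trans (cong (λ s → a ℤ.* (b ℤ.+ b′) ℤ.+ s) (·-distribˡ-⊕ c x y)) (regroup a b b′ (c · x) (c · y))
  where
  regroup : ∀ a b b′ p q → a ℤ.* (b ℤ.+ b′) ℤ.+ (p ℤ.+ q) ≡ (a ℤ.* b ℤ.+ p) ℤ.+ (a ℤ.* b′ ℤ.+ q)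
  regroup = solve-∀

·-zeroʳ : ∀ {n} (c : Pt n) → c · 𝟎 ≡ + 0
·-zeroʳ []      = refl
·-zeroʳ (a ∷ c) = cong₂ ℤ._+_ (ℤP.*-zeroʳ a) (·-zeroʳ c)

walkSum-++ : ∀ {n} (u w : List (Pt n)) → walkSum (u ++ w) ≡ walkSum u ⊕ walkSum w
walkSum-++ []      w = sym (⊕-identityˡ (walkSum w))
walkSum-++ (s ∷ u) w = trans (cong (s ⊕_) (walkSum-++ u w)) (sym (⊕-assoc s (walkSum u) (walkSum w)))

walkSum-map-⊝ : ∀ {n} (w : List (Pt n)) → walkSum (map ⊝_ w) ≡ ⊝ walkSum w
walkSum-map-⊝ []      = sym ⊝-𝟎
walkSum-map-⊝ (s ∷ w) = trans (cong ((⊝ s) ⊕_) (walkSum-map-⊝ w)) (sym (⊝-distrib-⊕ s (walkSum w)))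

·-walkSum-≤ : ∀ {n} (c : Pt n) (M : ℤ) {w : List (Pt n)} →
              All (λ t → c · t ℤ.≤ M) w → c · walkSum w ℤ.≤ + length w ℤ.* M
·-walkSum-≤ c M []                   = ℤP.≤-reflexive (trans (·-zeroʳ c) (sym (ℤP.*-zeroˡ M)))
·-walkSum-≤ c M {t ∷ w} (ct≤M ∷ w≤M) = begin
  c · (t ⊕ walkSum w)              ≡⟨ ·-distribˡ-⊕ c t (walkSum w) ⟩
  c · t ℤ.+ c · walkSum w          ≤⟨ ℤP.+-mono-≤ ct≤M (·-walkSum-≤ c M w≤M) ⟩
  M ℤ.+ + length w ℤ.* M           ≡⟨ ℤP.suc-* (+ length w) M ⟨
  + suc (length w) ℤ.* M           ∎
  where open ℤP.≤-Reasoning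

·-step-constant : ∀ {n} (c : Pt n) (M : ℤ) (γ : ℕ → Pt n) →
                  (∀ m → c · step γ m ≡ M) → ∀ m → c · γ m ≡ c · γ 0 ℤ.+ + m ℤ.* M
·-step-constant c M γ _ zero =
  sym (trans (cong (λ s → c · γ 0 ℤ.+ s) (ℤP.*-zeroˡ M)) (ℤP.+-identityʳ (c · γ 0)))
·-step-constant c M γ stepM (suc m) = begin
  c · γ (suc m)                               ≡⟨ cong (c ·_) (x⊕[y⊖x]≡y (γ m) (γ (suc m))) ⟨
  c · (γ m ⊕ step γ m)                        ≡⟨ ·-distribˡ-⊕ c (γ m) (step γ m) ⟩
  c · γ m ℤ.+ c · step γ m                    ≡⟨ cong₂ ℤ._+_ (·-step-constant c M γ stepM m) (stepM m) ⟩
  (c · γ 0 ℤ.+ + m ℤ.* M) ℤ.+ M               ≡⟨ regroup (c · γ 0) (+ m ℤ.* M) M ⟩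
  c · γ 0 ℤ.+ (M ℤ.+ + m ℤ.* M)               ≡⟨ cong (λ s → c · γ 0 ℤ.+ s) (ℤP.suc-* (+ m) M) ⟨
  c · γ 0 ℤ.+ + suc m ℤ.* M                   ∎
  where
  open ≡-Reasoning
  regroup : ∀ a b x → (a ℤ.+ b) ℤ.+ x ≡ a ℤ.+ (x ℤ.+ b)
  regroup = solve-∀

[+a]-[+b]≡1⇔a≡1+b : ∀ a b → (+ a) ℤ.- (+ b) ≡ + 1 ⇔ a ≡ suc b
[+a]-[+b]≡1⇔a≡1+b a b = mk⇔
  (λ diff≡1 → ℤP.+-injective (trans (undo (+ a) (+ b)) (cong (ℤ._+ + b) diff≡1)))
  (λ { refl → cancel (+ b) })
  where
  undo : ∀ x y → x ≡ (x ℤ.- y) ℤ.+ y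
  undo = solve-∀
  cancel : ∀ y → (+ 1 ℤ.+ y) ℤ.- y ≡ + 1
  cancel = solve-∀

¬¬-minimum : (f : ℕ → ℕ) → ¬ ¬ ∃ λ N → ∀ m → f N ≤ f m
¬¬-minimum f = descend (suc (f 0)) 0 ℕP.≤-refl
  where
  descend : ∀ b N → f N < b → ¬ ¬ ∃ λ N → ∀ m → f N ≤ f m
  descend (suc b) N fN<1+b noMinimum = noMinimum (N , λ m →
    decidable-stable (f N ≤? f m) λ fN≰fm →
      descend b m (ℕP.<-≤-trans (ℕP.≰⇒> fN≰fm) (ℕP.≤-pred fN<1+b)) noMinimum)

module Walks {n : ℕ} (S : List (Pt n)) where

  Walk : Pt n → Pt n → ℕ → Set
  Walk x y k = ∃ λ w → All (_∈ S) w × length w ≡ k × x ⊕ walkSum w ≡ y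

  []ʷ : ∀ x → Walk x x 0
  []ʷ x = [] , [] , refl , ⊕-identityʳ x

  [_]ʷ : ∀ {x s} → s ∈ S → Walk x (x ⊕ s) 1
  [_]ʷ {x} {s} s∈S = s ∷ [] , s∈S ∷ [] , refl , cong (x ⊕_) (⊕-identityʳ s)

  _++ʷ_ : ∀ {x y z k l} → Walk x y k → Walk y z l → Walk x z (k + l)
  _++ʷ_ {x} (u , u∈S , refl , u-ends) (w , w∈S , refl , w-ends) =
    u ++ w , ++⁺ u∈S w∈S , length-++ u , (begin
      x ⊕ walkSum (u ++ w)          ≡⟨ cong (x ⊕_) (walkSum-++ u w) ⟩
      x ⊕ (walkSum u ⊕ walkSum w)   ≡⟨ ⊕-assoc x (walkSum u) (walkSum w) ⟨
      (x ⊕ walkSum u) ⊕ walkSum w   ≡⟨ cong (_⊕ walkSum w) u-ends ⟩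
      _ ⊕ walkSum w                 ≡⟨ w-ends ⟩
      _                             ∎)
    where open ≡-Reasoning

  translateʷ : ∀ {x y k} t → Walk x y k → Walk (x ⊕ t) (y ⊕ t) k
  translateʷ {x} {y} t (w , w∈S , w-length , w-ends) = w , w∈S , w-length , (begin
    (x ⊕ t) ⊕ walkSum w   ≡⟨ ⊕-assoc x t (walkSum w) ⟩
    x ⊕ (t ⊕ walkSum w)   ≡⟨ cong (x ⊕_) (⊕-comm t (walkSum w)) ⟩
    x ⊕ (walkSum w ⊕ t)   ≡⟨ ⊕-assoc x (walkSum w) t ⟨
    (x ⊕ walkSum w) ⊕ t   ≡⟨ cong (_⊕ t) w-ends ⟩
    y ⊕ t                 ∎)
    where open ≡-Reasoning

  reverseʷ : Symmetric S → ∀ {x y k} → Walk x y k → Walk y x k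
  reverseʷ S-sym {x} {y} (w , w∈S , w-length , w-ends) =
    map ⊝_ w , map⁺ (All.map (S-sym _) w∈S) , trans (length-map ⊝_ w) w-length , (begin
      y ⊕ walkSum (map ⊝_ w)        ≡⟨ cong (y ⊕_) (walkSum-map-⊝ w) ⟩
      y ⊖ walkSum w                 ≡⟨ cong (_⊖ walkSum w) w-ends ⟨
      (x ⊕ walkSum w) ⊖ walkSum w   ≡⟨ [x⊕y]⊖y≡x x (walkSum w) ⟩
      x                             ∎)
    where open ≡-Reasoning

  ·-walk-≤ : ∀ (c : Pt n) {M} → (∀ t → t ∈ S → c · t ℤ.≤ M) →
             ∀ {x y k} → Walk x y k → c · y ℤ.≤ c · x ℤ.+ + k ℤ.* M
  ·-walk-≤ c {M} S≤M {x} (w , w∈S , refl , refl) = begin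
    c · (x ⊕ walkSum w)             ≡⟨ ·-distribˡ-⊕ c x (walkSum w) ⟩
    c · x ℤ.+ c · walkSum w         ≤⟨ ℤP.+-monoʳ-≤ (c · x) (·-walkSum-≤ c M (All.map (S≤M _) w∈S)) ⟩
    c · x ℤ.+ + length w ℤ.* M      ∎
    where open ℤP.≤-Reasoning

module Faces {n : ℕ} {S : List (Pt n)} where

  faceVertex⇒isVertex : ∀ F {v} → FaceVertex S F v → IsVertex S v
  faceVertex⇒isVertex (exposed c) (v-vertex , _) = v-vertex

  faceVertex-stable : ∀ F v → Stable (FaceVertex S F v)
  faceVertex-stable emptyFace   v ¬¬v∈F = ¬¬v∈F λ ()
  faceVertex-stable (exposed c) v ¬¬v∈F =
    ( decidable-stable (v ∈? S) (¬¬-map (proj₁ ∘ proj₁) ¬¬v∈F)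
    , negated-stable (¬¬-map (proj₂ ∘ proj₁) ¬¬v∈F) )
    , λ t t∈S → decidable-stable (c · t ℤ.≤? c · v) (¬¬-map (λ v∈F → proj₂ v∈F t t∈S) ¬¬v∈F)
    where open DecMembership (≡-dec ℤ._≟_) using (_∈?_)

  exposedFace-level : ∀ c {u u′} → FaceVertex S (exposed c) u → FaceVertex S (exposed c) u′ →
                      c · u ≡ c · u′
  exposedFace-level c ((u∈S , _) , u-max) ((u′∈S , _) , u′-max) =
    ℤP.≤-antisym (u′-max _ u∈S) (u-max _ u′∈S)

  vertex∉face⇒below : ∀ c {u v} → IsVertex S v → ¬ FaceVertex S (exposed c) v →
                      FaceVertex S (exposed c) u → c · v ℤ.< c · u
  vertex∉face⇒below c v-vertex v∉F (_ , u-max) =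
    ℤP.≰⇒> λ cu≤cv → v∉F (v-vertex , λ t t∈S → ℤP.≤-trans (u-max t t∈S) cu≤cv)

module CayleyGraph {n : ℕ} {S : List (Pt n)} (S-sym : Symmetric S)
                   {d : Pt n → Pt n → ℕ} (isDist : IsCayleyDist S d) where
  open Walks S
  open Faces

  shortestWalk : ∀ x y → Walk x y (d x y)
  shortestWalk x y = proj₁ (isDist x y)

  d-minimal : ∀ {x y k} → Walk x y k → d x y ≤ k
  d-minimal {x} {y} (w , w∈S , refl , w-ends) = proj₂ (isDist x y) w w∈S w-ends

  d-refl : ∀ x → d x x ≡ 0
  d-refl x = ℕP.n≤0⇒n≡0 (d-minimal ([]ʷ x))

  d-step : ∀ x {s} → s ∈ S → d x (x ⊕ s) ≤ 1
  d-step x s∈S = d-minimal [ s∈S ]ʷ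

  d-triangle : ∀ x y z → d x z ≤ d x y + d y z
  d-triangle x y z = d-minimal (shortestWalk x y ++ʷ shortestWalk y z)

  d-translate : ∀ t x y → d (x ⊕ t) (y ⊕ t) ≤ d x y
  d-translate t x y = d-minimal (translateʷ t (shortestWalk x y))

  d-sym : ∀ x y → d x y ≡ d y x
  d-sym x y = ℕP.≤-antisym (d-minimal (reverseʷ S-sym (shortestWalk y x)))
                           (d-minimal (reverseʷ S-sym (shortestWalk x y)))

  ·-d-≤ : ∀ (c : Pt n) {M} → (∀ t → t ∈ S → c · t ℤ.≤ M) →
          ∀ x y → c · y ℤ.≤ c · x ℤ.+ + d x y ℤ.* M
  ·-d-≤ c S≤M x y = ·-walk-≤ c S≤M (shortestWalk x y)

  geodesic-dist : ∀ {γ} → FullGeodesic d γ → ∀ i k → d (γ i) (γ (i + k)) ≡ k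
  geodesic-dist {γ} γ-geo i zero    = trans (cong (d (γ i) ∘ γ) (ℕP.+-identityʳ i)) (d-refl (γ i))
  geodesic-dist {γ} γ-geo i (suc k) =
    trans (γ-geo i (i + suc k) (ℕP.m<m+n i ℕ.z<s)) (ℕP.m+n∸m≡n i (suc k))

  ¬¬-receding : ∀ {γ} → FullGeodesic d γ → ∀ y →
                ¬ ¬ ∃ λ N → ∀ j → d (γ N) y + j ≤ d (γ (N + j)) y
  ¬¬-receding {γ} γ-geo y = ¬¬-map receding (¬¬-minimum defect)
    where
    open ℕP.≤-Reasoning
    A = d (γ 0) y
    defect : ℕ → ℕ
    defect m = A + d (γ m) y ∸ m
    below : ∀ m → m ≤ A + d (γ m) y
    below m = begin
      m                        ≡⟨ geodesic-dist γ-geo 0 m ⟨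
      d (γ 0) (γ m)            ≤⟨ d-triangle (γ 0) y (γ m) ⟩
      A + d y (γ m)            ≡⟨ cong (λ a → A + a) (d-sym y (γ m)) ⟩
      A + d (γ m) y            ∎
    receding : (∃ λ N → ∀ m → defect N ≤ defect m) → ∃ λ N → ∀ j → d (γ N) y + j ≤ d (γ (N + j)) y
    receding (N , minimal) = N , λ j → ℕP.+-cancelˡ-≤ A _ _ (begin
      A + (d (γ N) y + j)          ≡⟨ ℕP.+-assoc A (d (γ N) y) j ⟨
      A + d (γ N) y + j            ≡⟨ cong (_+ j) (ℕP.m∸n+n≡m (below N)) ⟨
      defect N + N + j             ≡⟨ ℕP.+-assoc (defect N) N j ⟩
      defect N + (N + j)           ≤⟨ ℕP.+-monoˡ-≤ (N + j) (minimal (N + j)) ⟩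
      defect (N + j) + (N + j)     ≡⟨ ℕP.m∸n+n≡m (below (N + j)) ⟩
      A + d (γ (N + j)) y          ∎)

  receding⇒dist-drop : ∀ {γ} → FullGeodesic d γ → ∀ {y N} →
    (∀ j → d (γ N) y + j ≤ d (γ (N + j)) y) → ∀ q r → step γ (N + q) ∈ S →
    d (γ (suc (N + q) + r)) y ≡ suc (d (γ (suc (N + q) + r)) (y ⊕ step γ (N + q)))
  receding⇒dist-drop {γ} γ-geo {y} {N} receding q r v∈S = ℕP.≤-antisym upper lower
    where
    open ℕP.≤-Reasoning
    v = step γ (N + q)
    p′ = suc (N + q)
    m = p′ + r
    upper : d (γ m) y ≤ suc (d (γ m) (y ⊕ v))
    upper = begin
      d (γ m) y                          ≤⟨ d-triangle (γ m) (y ⊕ v) y ⟩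
      d (γ m) (y ⊕ v) + d (y ⊕ v) y      ≡⟨ cong (λ a → d (γ m) (y ⊕ v) + a) (d-sym (y ⊕ v) y) ⟩
      d (γ m) (y ⊕ v) + d y (y ⊕ v)      ≤⟨ ℕP.+-monoʳ-≤ (d (γ m) (y ⊕ v)) (d-step y v∈S) ⟩
      d (γ m) (y ⊕ v) + 1                ≡⟨ ℕP.+-comm (d (γ m) (y ⊕ v)) 1 ⟩
      suc (d (γ m) (y ⊕ v))              ∎
    shifted-segment : d (γ N ⊕ v) (γ p′) ≤ q
    shifted-segment = begin
      d (γ N ⊕ v) (γ p′)                 ≡⟨ cong (d (γ N ⊕ v)) (x⊕[y⊖x]≡y (γ (N + q)) (γ p′)) ⟨
      d (γ N ⊕ v) (γ (N + q) ⊕ v)        ≤⟨ d-translate v (γ N) (γ (N + q)) ⟩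
      d (γ N) (γ (N + q))                ≡⟨ geodesic-dist γ-geo N q ⟩
      q                                  ∎
    regroup : ∀ a q r → suc (a + (q + r)) ≡ a + (q + suc r)
    regroup = ℕSolver.solve-∀
    index : N + (q + suc r) ≡ m
    index = trans (sym (ℕP.+-assoc N q (suc r))) (ℕP.+-suc (N + q) r)
    lower : suc (d (γ m) (y ⊕ v)) ≤ d (γ m) y
    lower = begin
      suc (d (γ m) (y ⊕ v))                                    ≡⟨ cong suc (d-sym (γ m) (y ⊕ v)) ⟩
      suc (d (y ⊕ v) (γ m))                                    ≤⟨ s≤s (d-triangle (y ⊕ v) (γ N ⊕ v) (γ m)) ⟩
      suc (d (y ⊕ v) (γ N ⊕ v) + d (γ N ⊕ v) (γ m))            ≤⟨ s≤s (ℕP.+-mono-≤ (d-translate v y (γ N))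
                                                                    (d-triangle (γ N ⊕ v) (γ p′) (γ m))) ⟩
      suc (d y (γ N) + (d (γ N ⊕ v) (γ p′) + d (γ p′) (γ m)))  ≤⟨ s≤s (ℕP.+-monoʳ-≤ (d y (γ N))
                                                                    (ℕP.+-mono-≤ shifted-segment
                                                                      (ℕP.≤-reflexive (geodesic-dist γ-geo p′ r)))) ⟩
      suc (d y (γ N) + (q + r))                                ≡⟨ cong (λ a → suc (a + (q + r))) (d-sym y (γ N)) ⟩
      suc (d (γ N) y + (q + r))                                ≡⟨ regroup (d (γ N) y) q r ⟩
      d (γ N) y + (q + suc r)                                  ≤⟨ receding (q + suc r) ⟩
      d (γ (N + (q + suc r))) y                                ≡⟨ cong (λ i → d (γ i) y) index ⟩
      d (γ m) y                                                ∎

  ¬¬-φ→1 : ∀ {γ} → FullGeodesic d γ → ∀ {v} → v ∈ S → InDirection γ v → ∀ y →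
           ¬ ¬ HasLimit {n = n} (λ m → φ d y (y ⊕ v) (γ m)) (+ 1)
  ¬¬-φ→1 {γ} γ-geo {v} v∈S v∈dir y = ¬¬-map limit (¬¬-receding γ-geo y)
    where
    limit : (∃ λ N → ∀ j → d (γ N) y + j ≤ d (γ (N + j)) y) → HasLimit {n = n} (λ m → φ d y (y ⊕ v) (γ m)) (+ 1)
    limit (N , receding) with v∈dir N
    ... | p , N≤p , refl with ℕP.m≤n⇒∃[o]m+o≡n N≤p
    ...   | q , refl = suc p , φ≡1
      where
      φ≡1 : ∀ m → suc p ≤ m → φ d y (y ⊕ step γ p) (γ m) ≡ + 1
      φ≡1 m p<m with ℕP.m≤n⇒∃[o]m+o≡n p<m
      ... | r , refl = Equivalence.from ([+a]-[+b]≡1⇔a≡1+b _ _) (receding⇒dist-drop γ-geo receding q r v∈S)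

  exposedFaceGeodesic⇒¬dist-drop : ∀ {η} → FullGeodesic d η → ∀ (c : Pt n) {M v} →
    (∀ m → c · step η m ≡ M) → (∀ t → t ∈ S → c · t ℤ.≤ M) → c · v ℤ.< M →
    ∀ m → d (η m) (η 0) ≢ suc (d (η m) (η 0 ⊕ v))
  exposedFaceGeodesic⇒¬dist-drop {η} _ c _ _ _ zero drop =
    ℕP.0≢1+n (trans (sym (d-refl (η 0))) drop)
  exposedFaceGeodesic⇒¬dist-drop {η} η-geo c {M} {v} stepM S≤M cv<M (suc k) drop = ℤP.<⇒≱ overshoot bound
    where
    η₀ = η 0
    k≡ : k ≡ d (η₀ ⊕ v) (η (suc k))
    k≡ = ℕP.suc-injective (begin
      suc k                          ≡⟨ geodesic-dist η-geo 0 (suc k) ⟨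
      d η₀ (η (suc k))               ≡⟨ d-sym η₀ (η (suc k)) ⟩
      d (η (suc k)) η₀               ≡⟨ drop ⟩
      suc (d (η (suc k)) (η₀ ⊕ v))   ≡⟨ cong suc (d-sym (η (suc k)) (η₀ ⊕ v)) ⟩
      suc (d (η₀ ⊕ v) (η (suc k)))   ∎)
      where open ≡-Reasoning
    bound : c · η₀ ℤ.+ (M ℤ.+ + k ℤ.* M) ℤ.≤ (c · η₀ ℤ.+ c · v) ℤ.+ + k ℤ.* M
    bound = begin
      c · η₀ ℤ.+ (M ℤ.+ + k ℤ.* M)                     ≡⟨ cong (λ s → c · η₀ ℤ.+ s) (ℤP.suc-* (+ k) M) ⟨
      c · η₀ ℤ.+ + suc k ℤ.* M                         ≡⟨ ·-step-constant c M η stepM (suc k) ⟨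
      c · η (suc k)                                    ≤⟨ ·-d-≤ c S≤M (η₀ ⊕ v) (η (suc k)) ⟩
      c · (η₀ ⊕ v) ℤ.+ + d (η₀ ⊕ v) (η (suc k)) ℤ.* M  ≡⟨ cong₂ (λ a b → a ℤ.+ + b ℤ.* M) (·-distribˡ-⊕ c η₀ v) (sym k≡) ⟩
      (c · η₀ ℤ.+ c · v) ℤ.+ + k ℤ.* M                 ∎
      where open ℤP.≤-Reasoning
    overshoot : (c · η₀ ℤ.+ c · v) ℤ.+ + k ℤ.* M ℤ.< c · η₀ ℤ.+ (M ℤ.+ + k ℤ.* M)
    overshoot = begin-strict
      (c · η₀ ℤ.+ c · v) ℤ.+ + k ℤ.* M   ≡⟨ ℤP.+-assoc (c · η₀) (c · v) (+ k ℤ.* M) ⟩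
      c · η₀ ℤ.+ (c · v ℤ.+ + k ℤ.* M)   <⟨ ℤP.+-monoʳ-< (c · η₀) (ℤP.+-monoˡ-< (+ k ℤ.* M) cv<M) ⟩
      c · η₀ ℤ.+ (M ℤ.+ + k ℤ.* M)       ∎
      where open ℤP.≤-Reasoning

  φ≢1-along-faceGeodesic : ∀ {η G v} → FullGeodesic d η → AllStepsInDirection η →
    DirectionIsVertexSetOf S η G → IsVertex S v → ¬ FaceVertex S G v →
    ∀ m → φ d (η 0) (η 0 ⊕ v) (η m) ≢ + 1
  φ≢1-along-faceGeodesic {η} {emptyFace} _ η-steps η-dir _ _ _ _ =
    Equivalence.to (η-dir (step η 0)) (η-steps 0)
  φ≢1-along-faceGeodesic {η} {exposed c} η-geo η-steps η-dir v-vertex v∉G m φ≡1 =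
    exposedFaceGeodesic⇒¬dist-drop η-geo c level (proj₂ (onFace 0))
      (vertex∉face⇒below c v-vertex v∉G (onFace 0)) m (Equivalence.to ([+a]-[+b]≡1⇔a≡1+b _ _) φ≡1)
    where
    onFace : ∀ m → FaceVertex S (exposed c) (step η m)
    onFace m = Equivalence.to (η-dir (step η m)) (η-steps m)
    level : ∀ m → c · step η m ≡ c · step η 0
    level m = exposedFace-level c (onFace m) (onFace 0)

  equivalent⇒¬¬faceVertex⊆ : ∀ {γ η F G} → FullGeodesic d γ → FullGeodesic d η →
    AllStepsInDirection η → DirectionIsVertexSetOf S γ F → DirectionIsVertexSetOf S η G →
    Equivalent d γ η → ∀ v → FaceVertex S F v → ¬ ¬ FaceVertex S G v
  equivalent⇒¬¬faceVertex⊆ {γ} {η} {F} γ-geo η-geo η-steps γ-dir η-dir γ≈η v v∈F v∉G =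
    ¬¬-φ→1 γ-geo (proj₁ v-vertex) (Equivalence.from (γ-dir v) v∈F) (η 0) λ γ-limit →
      let N , η-limit = Equivalence.to (γ≈η (phi (η 0) (η 0 ⊕ v)) (+ 1)) γ-limit
      in φ≢1-along-faceGeodesic η-geo η-steps η-dir v-vertex v∉G N (η-limit N ℕP.≤-refl)
    where
    v-vertex = faceVertex⇒isVertex F v∈F

Equivalent-sym : ∀ {n} {d : Pt n → Pt n → ℕ} {γ η} → Equivalent d γ η → Equivalent d η γ
Equivalent-sym γ≈η e a = ⇔.sym (γ≈η e a)

mainTheorem8 : (n : ℕ) (S : List (Pt n)) → Symmetric S → Generates S →
    (d : Pt n → Pt n → ℕ) → IsCayleyDist S d →
    (γ η : ℕ → Pt n) → FullGeodesic d γ → FullGeodesic d η →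
    AllStepsInDirection γ → AllStepsInDirection η →
    (F G : Face {n}) → DirectionIsVertexSetOf S γ F → DirectionIsVertexSetOf S η G →
    ¬ SameFace S F G →
    ¬ Equivalent d γ η
mainTheorem8 n S S-sym _ d isDist γ η γ-geo η-geo γ-steps η-steps F G γ-dir η-dir F≠G γ≈η =
  F≠G λ v → mk⇔
    (faceVertex-stable G v ∘ equivalent⇒¬¬faceVertex⊆ γ-geo η-geo η-steps γ-dir η-dir γ≈η v)
    (faceVertex-stable F v ∘ equivalent⇒¬¬faceVertex⊆ η-geo γ-geo γ-steps η-dir γ-dir (Equivalent-sym γ≈η) v)
  where
  open Faces
  open CayleyGraph S-sym isDist
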